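{- Let $\mathcal{X},\mathcal{Y}$ be disjoint finite sets and let $Q=\mathcal{Q}(\mathcal{X}\cup\mathcal{Y})$ be colored blue/red with no blue copy of $\Lambda$. Let $X\subseteq\mathcal{X}$ and let $S$ be an ordered subset of $\mathcal{Y}$ with underlying set $\underline{S}$, such that $(X,\underline{S})$ is not embeddable. Then there exists $X'\subseteq\mathcal{X}$ with $X'\supseteq X$ such that $(X',\underline{S})$ is blue and not embeddable.
   Context: $\mathcal{Q}(\mathcal{S})$ is the Boolean lattice of all subsets of $\mathcal{S}$ ordered by inclusion. For $X\subseteq\mathcal{X}$, $Y\subseteq\mathcal{Y}$, $(X,Y)$ denotes the element $X\cup Y$ of $Q$. An ordered subset of $\mathcal{Y}$ is a subset of $\mathcal{Y}$ with a linear order on it. A poset embedding is an injective map $\phi$ with $a\le b$ iff $\phi(a)\le\phi(b)$. $\Lambda$ is the poset on $Z_1,Z_2,Z_3$ with $Z_1<Z_3$, $Z_2<Z_3$, $Z_1,Z_2$ incomparable; a blue copy is a set of blue elements isomorphic to it under inclusion. The vertex $(X,Y)$ is embeddable if there is an embedding $\phi$ of $\{X'\subseteq\mathcal{X}: X'\supseteq X\}$ (ordered by inclusion) into $Q$ such that every $\phi(X')$ is red, $\phi(X')\cap\mathcal{X}=X'$ for all $X'$, and $\phi(X)\supseteq X\cup Y$. -}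

module Defs where

open import Data.Nat using (ℕ)
open import Data.Fin.Subset using (Subset; _⊆_)
open import Data.Product using (_×_; _,_; proj₁; proj₂; Σ; ∃)
open import Data.Empty using (⊥)
open import Relation.Nullary using (¬_)
open import Relation.Binary.PropositionalEquality using (_≡_)
open import Function.Bundles using (_⇔_)

-- 𝒳 = Fin m, 𝒴 = Fin n (disjoint finite sets).  An element (X , Y) of
-- Q = 𝒬(𝒳 ∪ 𝒴) is the set X ∪ Y; by disjointness Q is identified with
-- Subset m × Subset n, and inclusion is componentwise inclusion.
Q : ℕ → ℕ → Set
Q m n = Subset m × Subset n

_≤Q_ : ∀ {m n} → Q m n → Q m n → Set
(X₁ , Y₁) ≤Q (X₂ , Y₂) = (X₁ ⊆ X₂) × (Y₁ ⊆ Y₂)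

data Color : Set where
  blue red : Color

Coloring : ℕ → ℕ → Set
Coloring m n = Q m n → Color

BlueΛ : ∀ {m n} → Coloring m n → Set
BlueΛ {m} {n} c =
  Σ (Q m n) λ A → Σ (Q m n) λ B → Σ (Q m n) λ C →
    (c A ≡ blue) × (c B ≡ blue) × (c C ≡ blue) ×
    (A ≤Q C) × (B ≤Q C) × ¬ (A ≤Q B) × ¬ (B ≤Q A)

NoBlueΛ : ∀ {m n} → Coloring m n → Set
NoBlueΛ c = ¬ BlueΛ c

Embeddable : ∀ {m n} → Coloring m n → Subset m → Subset n → Set
Embeddable {m} {n} c X Y =
  Σ (Subset m → Q m n) λ φ →
    (∀ A B → X ⊆ A → X ⊆ B → φ A ≡ φ B → A ≡ B) ×
    (∀ A B → X ⊆ A → X ⊆ B → (A ⊆ B ⇔ (φ A ≤Q φ B))) ×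
    (∀ A → X ⊆ A → c (φ A) ≡ red) ×
    (∀ A → X ⊆ A → proj₁ (φ A) ≡ A) ×
    ((X , Y) ≤Q φ X)

-- Suppose every blue set (B , S) with B ⊇ X were embeddable, with embedding φ_B.
-- Build an embedding of (X , S) by sending A ⊇ X to (A , T A), where T A is
--   · all of 𝒴, if A contains two incomparable blue sets (B₁ , S), (B₂ , S): then
--     (A , 𝒴) is red, for otherwise it would top a blue Λ;
--   · the 𝒴-part of φ_B(A), if the blue sets below A form a nonempty chain with
--     least element B; this least element stays the same as A grows, so T is
--     monotone;
--   · S, if there are no blue sets below A: then (A , S) itself is red.
-- All notions involved are decidable, since Q is finite, so the contrapositive
-- yields an explicit blue, non-embeddable (X' , S).
module Submission where

open import Defs
open import Level using (0ℓ)
open import Data.Nat using (ℕ; zero; suc)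
open import Data.Nat.Induction using (<-wellFounded)
open import Data.Bool using (_≟_)
open import Data.Vec using ([]; _∷_)
open import Data.Vec.Properties using (≡-dec)
import Data.Product.Properties as Product
open import Data.Fin.Properties using (any?)
open import Data.Fin.Subset using (Subset; _⊆_; _⊈_; _⊂_; ⊤; ∣_∣; inside; outside)
open import Data.Fin.Subset.Properties
  using (anySubset?; _⊆?_; _∈?_; ⊆⊤; ⊆-refl; ⊆-trans; ⊆-antisym; p⊂q⇒∣p∣<∣q∣)
open import Data.Product using (Σ; ∃; ∃₂; _×_; _,_; proj₁; proj₂)
open import Data.Empty using (⊥-elim)
open import Function using (_∘_)
open import Function.Bundles using (_⇔_; mk⇔; Equivalence)
open import Induction.WellFounded using (WellFounded; Acc; acc; module Subrelation)
import Relation.Binary.Construct.On as On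
open import Relation.Binary using (DecidableEquality)
open import Relation.Nullary using (¬_; Dec; yes; no)
open import Relation.Nullary.Decidable
  using (decidable-stable; recompute; _×-dec_; _→-dec_; ¬?; map′)
import Relation.Nullary.Decidable as Dec
open import Relation.Unary using (Pred; Decidable)
open import Relation.Binary.PropositionalEquality
  using (_≡_; refl; sym; trans; cong; subst; subst₂; _≗_)

Searchable : Set → Set₁
Searchable A = {P : Pred A 0ℓ} → Decidable P → Dec (∃ P)

×-searchable : ∀ {A B} → Searchable A → Searchable B → Searchable (A × B)
×-searchable searchA searchB P? =
  Dec.map (mk⇔ (λ { (a , b , p) → (a , b) , p }) (λ { ((a , b) , p) → a , b , p }))
          (searchA (λ a → searchB (λ b → P? (a , b))))

searchable⇒all? : ∀ {A} → Searchable A → {P : Pred A 0ℓ} → Decidable P → Dec (∀ a → P a)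
searchable⇒all? search P? =
  map′ (λ ∄¬P a → decidable-stable (P? a) (λ ¬Pa → ∄¬P (a , ¬Pa)))
       (λ ∀P (a , ¬Pa) → ¬Pa (∀P a))
       (¬? (search (¬? ∘ P?)))

-- Without function extensionality a predicate may tell pointwise equal functions
-- apart; a search over functions can only decide predicates that do not.
Extensional : ∀ {A B : Set} → Pred (A → B) 0ℓ → Set
Extensional P = ∀ {f g} → f ≗ g → P f → P g

join : ∀ {k} {B : Set} → (Subset k → B) → (Subset k → B) → Subset (suc k) → B
join f₀ f₁ (outside ∷ p) = f₀ p
join f₀ f₁ (inside ∷ p) = f₁ p

join-split : ∀ {k} {B : Set} (f : Subset (suc k) → B) →
             f ≗ join (f ∘ (outside ∷_)) (f ∘ (inside ∷_))
join-split f (outside ∷ p) = refl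
join-split f (inside ∷ p) = refl

join-congˡ : ∀ {k} {B : Set} {f₀ g₀ : Subset k → B} (f₁ : Subset k → B) →
             f₀ ≗ g₀ → join f₀ f₁ ≗ join g₀ f₁
join-congˡ f₁ f₀≗g₀ (outside ∷ p) = f₀≗g₀ p
join-congˡ f₁ f₀≗g₀ (inside ∷ p) = refl

join-congʳ : ∀ {k} {B : Set} (f₀ : Subset k → B) {f₁ g₁ : Subset k → B} →
             f₁ ≗ g₁ → join f₀ f₁ ≗ join f₀ g₁
join-congʳ f₀ f₁≗g₁ (outside ∷ p) = refl
join-congʳ f₀ f₁≗g₁ (inside ∷ p) = f₁≗g₁ p

anyFunction? : ∀ k {B} → Searchable B → {P : Pred (Subset k → B) 0ℓ} →
               Extensional P → Decidable P → Dec (∃ P)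
anyFunction? zero searchB {P} P-ext P? =
  Dec.map (mk⇔ (λ (b , p) → _ , p) (λ (f , p) → f [] , P-ext constant p))
          (searchB (λ b → P? (λ _ → b)))
  where
  constant : ∀ {f : Subset zero → _} → f ≗ (λ _ → f [])
  constant [] = refl
anyFunction? (suc k) {B} searchB {P} P-ext P? =
  Dec.map split⇔ (anyFunction? k searchB ∃-ext (λ f₀ → anyFunction? k searchB
    (λ f₁≗g₁ → P-ext (join-congʳ f₀ f₁≗g₁)) (λ f₁ → P? (join f₀ f₁))))
  where
  Halves : Pred (Subset k → B) 0ℓ
  Halves f₀ = ∃ λ f₁ → P (join f₀ f₁)

  ∃-ext : Extensional Halves
  ∃-ext f₀≗g₀ (f₁ , p) = f₁ , P-ext (join-congˡ f₁ f₀≗g₀) p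

  split⇔ : ∃ Halves ⇔ ∃ P
  split⇔ = mk⇔ (λ (f₀ , f₁ , p) → join f₀ f₁ , p)
               (λ (f , p) → _ , _ , P-ext (join-split f) p)

_⇔?_ : ∀ {A B : Set} → Dec A → Dec B → Dec (A ⇔ B)
a? ⇔? b? = map′ (λ (to , from) → mk⇔ to from)
                (λ A⇔B → Equivalence.to A⇔B , Equivalence.from A⇔B)
                ((a? →-dec b?) ×-dec (b? →-dec a?))

_≟ˢ_ : ∀ {k} → DecidableEquality (Subset k)
_≟ˢ_ = ≡-dec _≟_

_≟ᶜ_ : DecidableEquality Color
blue ≟ᶜ blue = yes refl
red  ≟ᶜ red  = yes refl
blue ≟ᶜ red  = no λ ()
red  ≟ᶜ blue = no λ ()

≢blue⇒≡red : ∀ {col} → ¬ col ≡ blue → col ≡ red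
≢blue⇒≡red {blue} col≢blue = ⊥-elim (col≢blue refl)
≢blue⇒≡red {red}  col≢blue = refl

module _ {m n : ℕ} where

  _≟Q_ : DecidableEquality (Q m n)
  _≟Q_ = Product.≡-dec _≟ˢ_ _≟ˢ_

  _≤Q?_ : (a b : Q m n) → Dec (a ≤Q b)
  (X₁ , Y₁) ≤Q? (X₂ , Y₂) = (X₁ ⊆? X₂) ×-dec (Y₁ ⊆? Y₂)

  Q-searchable : Searchable (Q m n)
  Q-searchable = ×-searchable anySubset? anySubset?

  EmbeddingWitness : Coloring m n → Subset m → Subset n → Pred (Subset m → Q m n) 0ℓ
  EmbeddingWitness c X Y φ =
    (∀ A B → X ⊆ A → X ⊆ B → φ A ≡ φ B → A ≡ B) ×
    (∀ A B → X ⊆ A → X ⊆ B → (A ⊆ B ⇔ (φ A ≤Q φ B))) ×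
    (∀ A → X ⊆ A → c (φ A) ≡ red) ×
    (∀ A → X ⊆ A → proj₁ (φ A) ≡ A) ×
    ((X , Y) ≤Q φ X)

  embeddingWitness-ext : ∀ c X Y → Extensional (EmbeddingWitness c X Y)
  embeddingWitness-ext c X Y {φ} {ψ} φ≗ψ (injective , order , isRed , first , base) =
    (λ A B X⊆A X⊆B ψA≡ψB → injective A B X⊆A X⊆B (trans (φ≗ψ A) (trans ψA≡ψB (sym (φ≗ψ B))))) ,
    (λ A B X⊆A X⊆B → mk⇔
      (λ (A⊆B : A ⊆ B) → subst₂ _≤Q_ (φ≗ψ A) (φ≗ψ B) (Equivalence.to (order A B X⊆A X⊆B) A⊆B))
      (λ ψA≤ψB → Equivalence.from (order A B X⊆A X⊆B)
                   (subst₂ _≤Q_ (sym (φ≗ψ A)) (sym (φ≗ψ B)) ψA≤ψB))) ,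
    (λ A X⊆A → subst (λ a → c a ≡ red) (φ≗ψ A) (isRed A X⊆A)) ,
    (λ A X⊆A → subst (λ a → proj₁ a ≡ A) (φ≗ψ A) (first A X⊆A)) ,
    subst ((X , Y) ≤Q_) (φ≗ψ X) base

  embeddingWitness? : ∀ c X Y → Decidable (EmbeddingWitness c X Y)
  embeddingWitness? c X Y φ =
    all₂ (λ A B → (X ⊆? A) →-dec (X ⊆? B) →-dec (φ A ≟Q φ B) →-dec (A ≟ˢ B)) ×-dec
    all₂ (λ A B → (X ⊆? A) →-dec (X ⊆? B) →-dec ((A ⊆? B) ⇔? (φ A ≤Q? φ B))) ×-dec
    all (λ A → (X ⊆? A) →-dec (c (φ A) ≟ᶜ red)) ×-dec
    all (λ A → (X ⊆? A) →-dec (proj₁ (φ A) ≟ˢ A)) ×-dec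
    ((X , Y) ≤Q? φ X)
    where
    all : {P : Pred (Subset m) 0ℓ} → Decidable P → Dec (∀ A → P A)
    all = searchable⇒all? anySubset?
    all₂ : {P : Subset m → Subset m → Set} → (∀ A B → Dec (P A B)) → Dec (∀ A B → P A B)
    all₂ P? = all (λ A → all (P? A))

  embeddable? : ∀ c X Y → Dec (Embeddable c X Y)
  embeddable? c X Y = anyFunction? m Q-searchable (embeddingWitness-ext c X Y) (embeddingWitness? c X Y)

module _ {m n : ℕ} (c : Coloring m n) (B : Subset m) (Y : Subset n) where

  trace : Embeddable c B Y → Subset m → Subset n
  trace (φ , _) = proj₂ ∘ φ

  trace-mono : ∀ (e : Embeddable c B Y) {A A'} → B ⊆ A → A ⊆ A' → trace e A ⊆ trace e A'
  trace-mono (_ , _ , order , _) B⊆A A⊆A' =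
    proj₂ (Equivalence.to (order _ _ B⊆A (⊆-trans B⊆A A⊆A')) A⊆A')

  ⊆-trace : ∀ (e : Embeddable c B Y) {A} → B ⊆ A → Y ⊆ trace e A
  ⊆-trace e@(_ , _ , _ , _ , _ , B≤φB) B⊆A = ⊆-trans (proj₂ B≤φB) (trace-mono e ⊆-refl B⊆A)

  trace-red : ∀ (e : Embeddable c B Y) {A} → B ⊆ A → c (A , trace e A) ≡ red
  trace-red (φ , _ , _ , isRed , first , _) {A} B⊆A =
    subst (λ A' → c (A' , proj₂ (φ A)) ≡ red) (first A B⊆A) (isRed A B⊆A)

p⊆q∧q⊈p⇒p⊂q : ∀ {k} {p q : Subset k} → p ⊆ q → q ⊈ p → p ⊂ q
p⊆q∧q⊈p⇒p⊂q {p = p} {q} p⊆q q⊈p with any? (λ x → (x ∈? q) ×-dec ¬? (x ∈? p))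
... | yes (x , x∈q , x∉p) = p⊆q , x , x∈q , x∉p
... | no ∄ = ⊥-elim (q⊈p λ {x} x∈q → decidable-stable (x ∈? p) (λ x∉p → ∄ (x , x∈q , x∉p)))

⊂-wellFounded : ∀ {k} → WellFounded (_⊂_ {k})
⊂-wellFounded = Subrelation.wellFounded p⊂q⇒∣p∣<∣q∣ (On.wellFounded ∣_∣ <-wellFounded)

module _ {k : ℕ} (P : Pred (Subset k) 0ℓ) where

  Least : Pred (Subset k) 0ℓ
  Least p = P p × (∀ q → P q → p ⊆ q)

  Incomparable : Set
  Incomparable = ∃₂ λ p q → P p × P q × p ⊈ q × q ⊈ p

module _ {k : ℕ} {P : Pred (Subset k) 0ℓ} (P? : Decidable P) where

  least? : Dec (∃ (Least P))
  least? = anySubset? λ p → P? p ×-dec searchable⇒all? anySubset? (λ q → P? q →-dec (p ⊆? q))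

  incomparable? : Dec (Incomparable P)
  incomparable? = anySubset? λ p → anySubset? λ q →
    P? p ×-dec P? q ×-dec ¬? (p ⊆? q) ×-dec ¬? (q ⊆? p)

  chain⇒least : ¬ Incomparable P → ∀ {p} → P p → ∃ (Least P)
  chain⇒least chain Pp = below (⊂-wellFounded _) Pp
    where
    below : ∀ {p} → Acc _⊂_ p → P p → ∃ (Least P)
    below {p} (acc smaller) Pp with anySubset? (λ q → P? q ×-dec ¬? (p ⊆? q))
    ... | no ∄ = p , Pp , λ q Pq → decidable-stable (p ⊆? q) (λ p⊈q → ∄ (q , Pq , p⊈q))
    ... | yes (q , Pq , p⊈q) = below (smaller (p⊆q∧q⊈p⇒p⊂q q⊆p p⊈q)) Pq
      where
      q⊆p : q ⊆ p
      q⊆p = decidable-stable (q ⊆? p) (λ q⊈p → chain (p , q , Pp , Pq , p⊈q , q⊈p))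

module _ {m n : ℕ} (c : Coloring m n) (X : Subset m) (S : Subset n) where

  BlueAbove : Pred (Subset m) 0ℓ
  BlueAbove B = X ⊆ B × c (B , S) ≡ blue

  BlueWithin : Subset m → Pred (Subset m) 0ℓ
  BlueWithin A B = BlueAbove B × B ⊆ A

  blueWithin? : ∀ A → Decidable (BlueWithin A)
  blueWithin? A B = ((X ⊆? B) ×-dec (c (B , S) ≟ᶜ blue)) ×-dec (B ⊆? A)

  incomparableWithin? : ∀ A → Dec (Incomparable (BlueWithin A))
  incomparableWithin? A = incomparable? (blueWithin? A)

  leastWithin? : ∀ A → Dec (∃ (Least (BlueWithin A)))
  leastWithin? A = least? (blueWithin? A)

  module _ {A A' : Subset m} (A⊆A' : A ⊆ A') where

    incomparable-⊆ : Incomparable (BlueWithin A) → Incomparable (BlueWithin A')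
    incomparable-⊆ (B₁ , B₂ , (blue₁ , B₁⊆A) , (blue₂ , B₂⊆A) , incomparable) =
      B₁ , B₂ , (blue₁ , ⊆-trans B₁⊆A A⊆A') , (blue₂ , ⊆-trans B₂⊆A A⊆A') , incomparable

    least-⊆ : ¬ Incomparable (BlueWithin A') →
              ∃ (Least (BlueWithin A)) → ∃ (Least (BlueWithin A'))
    least-⊆ chain (B , (blueB , B⊆A) , _) =
      chain⇒least (blueWithin? A') chain (blueB , ⊆-trans B⊆A A⊆A')

    least-unique-⊆ : ∀ {B B'} → Least (BlueWithin A) B → Least (BlueWithin A') B' → B ≡ B'
    least-unique-⊆ ((blueB , B⊆A) , leastB) ((blueB' , _) , leastB') =
      ⊆-antisym (leastB _ (blueB' , ⊆-trans B'⊆B B⊆A)) B'⊆B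
      where
      B'⊆B = leastB' _ (blueB , ⊆-trans B⊆A A⊆A')

  no-least⇒red : ∀ {A} → X ⊆ A → ¬ Incomparable (BlueWithin A) →
                 ¬ ∃ (Least (BlueWithin A)) → c (A , S) ≡ red
  no-least⇒red {A} X⊆A chain ∄least =
    ≢blue⇒≡red λ blueA → ∄least (chain⇒least (blueWithin? A) chain ((X⊆A , blueA) , ⊆-refl))

  incomparable⇒⊤-red : NoBlueΛ c → ∀ {A} → Incomparable (BlueWithin A) → c (A , ⊤) ≡ red
  incomparable⇒⊤-red noΛ {A} (B₁ , B₂ , ((_ , blue₁) , B₁⊆A) , ((_ , blue₂) , B₂⊆A) , B₁⊈B₂ , B₂⊈B₁) =
    ≢blue⇒≡red λ blueA → noΛ ((B₁ , S) , (B₂ , S) , (A , ⊤) , blue₁ , blue₂ , blueA ,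
      (B₁⊆A , ⊆⊤) , (B₂⊆A , ⊆⊤) , (B₁⊈B₂ ∘ proj₁) , (B₂⊈B₁ ∘ proj₁))

  -- The blueness proof is irrelevant, so the embedding chosen for B depends on B
  -- alone; this is what lets T′-mono identify the least elements of A and A'.
  module _ (embedding : ∀ B → .(BlueAbove B) → Embeddable c B S) where

    T′ : ∀ A → Dec (Incomparable (BlueWithin A)) → Dec (∃ (Least (BlueWithin A))) → Subset n
    T′ A (yes _) _                           = ⊤
    T′ A (no _)  (yes (B , (blueB , _) , _)) = trace c B S (embedding B blueB) A
    T′ A (no _)  (no _)                      = S

    T′-mono : ∀ {A A'} → A ⊆ A' → ∀ i l i' l' → T′ A i l ⊆ T′ A' i' l'
    T′-mono A⊆A' i l (yes _) l' = ⊆⊤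
    T′-mono A⊆A' (yes incomparable) l (no chain') l' =
      ⊥-elim (chain' (incomparable-⊆ A⊆A' incomparable))
    T′-mono A⊆A' (no _) (yes least) (no chain') (no ∄least') =
      ⊥-elim (∄least' (least-⊆ A⊆A' chain' (_ , proj₂ least)))
    T′-mono A⊆A' (no _) (yes (B , leastB)) (no _) (yes (B' , leastB'))
      with refl ← least-unique-⊆ A⊆A' leastB leastB' =
      trace-mono c B S (embedding B (proj₁ (proj₁ leastB))) (proj₂ (proj₁ leastB)) A⊆A'
    T′-mono A⊆A' (no _) (no _) (no _) (yes (B' , (blueB' , B'⊆A') , _)) =
      ⊆-trace c B' S (embedding B' blueB') B'⊆A'
    T′-mono A⊆A' (no _) (no _) (no _) (no _) = ⊆-refl

    T′-red : NoBlueΛ c → ∀ {A} → X ⊆ A → ∀ i l → c (A , T′ A i l) ≡ red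
    T′-red noΛ X⊆A (yes incomparable) l = incomparable⇒⊤-red noΛ incomparable
    T′-red noΛ X⊆A (no _) (yes (B , (blueB , B⊆A) , _)) = trace-red c B S (embedding B blueB) B⊆A
    T′-red noΛ X⊆A (no chain) (no ∄least) = no-least⇒red X⊆A chain ∄least

    S⊆T′ : ∀ {A} i l → S ⊆ T′ A i l
    S⊆T′ (yes _) l = ⊆⊤
    S⊆T′ (no _) (yes (B , (blueB , B⊆A) , _)) = ⊆-trace c B S (embedding B blueB) B⊆A
    S⊆T′ (no _) (no _) = ⊆-refl

    T : Subset m → Subset n
    T A = T′ A (incomparableWithin? A) (leastWithin? A)

    T-mono : ∀ {A A'} → A ⊆ A' → T A ⊆ T A'
    T-mono {A} {A'} A⊆A' =
      T′-mono A⊆A' (incomparableWithin? A) (leastWithin? A) (incomparableWithin? A') (leastWithin? A')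

    T-red : NoBlueΛ c → ∀ {A} → X ⊆ A → c (A , T A) ≡ red
    T-red noΛ {A} X⊆A = T′-red noΛ X⊆A (incomparableWithin? A) (leastWithin? A)

    S⊆T : ∀ A → S ⊆ T A
    S⊆T A = S⊆T′ (incomparableWithin? A) (leastWithin? A)

    blue-embeddable⇒embeddable : NoBlueΛ c → Embeddable c X S
    blue-embeddable⇒embeddable noΛ =
      (λ A → A , T A) ,
      (λ A B _ _ → cong proj₁) ,
      (λ A B _ _ → order A B) ,
      (λ A X⊆A → T-red noΛ X⊆A) ,
      (λ A _ → refl) ,
      (⊆-refl , S⊆T X)
      where
      order : ∀ A A' → A ⊆ A' ⇔ ((A , T A) ≤Q (A' , T A'))
      order A A' = mk⇔ {A = A ⊆ A'} {B = (A , T A) ≤Q (A' , T A')}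
                       (λ A⊆A' → A⊆A' , T-mono A⊆A') proj₁

corollary16 : (m n : ℕ) (c : Coloring m n) → NoBlueΛ c →
    (X : Subset m) (S : Subset n) → ¬ Embeddable c X S →
    Σ (Subset m) λ X' → (X ⊆ X') × (c (X' , S) ≡ blue) × ¬ Embeddable c X' S
corollary16 m n c noΛ X S ¬embeddable
  with anySubset? (λ X' → (X ⊆? X') ×-dec (c (X' , S) ≟ᶜ blue) ×-dec ¬? (embeddable? c X' S))
... | yes witness = witness
... | no ∄witness = ⊥-elim (¬embeddable (blue-embeddable⇒embeddable c X S embedding noΛ))
  where
  embedding : ∀ B → .(BlueAbove c X S B) → Embeddable c B S
  embedding B blueB = recompute (embeddable? c B S)
    (decidable-stable (embeddable? c B S) (λ ¬e → ∄witness (B , proj₁ blueB , proj₂ blueB , ¬e)))
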